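{- For every positive integer $n$, \[\sum_{i=1}^{n}\frac{1}{2i}{n+1\choose 2i}=\sum_{s=1}^{n}\frac{2^{s}-1}{s+1}.\]
   Context: Binomial coefficients ${a\choose b}$ are $0$ when $b>a$. -}

module Defs where

open import Data.Nat using (ℕ; zero; suc; _+_; _*_; _∸_; _^_)
open import Data.Nat.Combinatorics using (_C_)
open import Data.Integer using (+_)
open import Data.Rational using (ℚ; _/_) renaming (_+_ to _+ℚ_; 0ℚ to 0q)

Σ₁ : ℕ → (ℕ → ℚ) → ℚ
Σ₁ zero    f = 0q
Σ₁ (suc n) f = Σ₁ n f +ℚ f (suc n)

-- the term (1/(2i)) * C(n+1, 2i), written as the rational C(n+1,2i) / (2i);
-- for i ≥ 1 we write 2i = suc (2i ∸ 1) so the denominator is visibly nonzero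
lhsTerm : ℕ → ℕ → ℚ
lhsTerm n zero    = 0q
lhsTerm n (suc k) = (+ ((n + 1) C (2 * suc k))) / suc (suc (2 * k))

-- the term (2^s - 1)/(s+1)  (2^s ≥ 1, so natural subtraction is exact)
rhsTerm : ℕ → ℚ
rhsTerm s = (+ (2 ^ s ∸ 1)) / suc s

module Submission where

-- Write L(n) for the left-hand side.  The proof is by induction on n, the
-- right-hand side growing by (2^{n+1} − 1)/(n+2) at each step, so it suffices
-- to show  L(n+1) = L(n) + (2^{n+1} − 1)/(n+2).
--   * Pascal's rule and the absorption identity (k+1)·C(N+1,k+1) = (N+1)·C(N,k)
--     split every term:  C(N+1,k+1)/(k+1) = C(N+1,k+1)/(N+1) + C(N,k+1)/(k+1).
--   * Summed over i = 1..n+1 with N = n+1, k+1 = 2i, this gives L(n+1) as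
--     Σ_i C(n+2,2i)/(n+2) plus L(n) (the extra term C(n+1,2n+2) vanishes).
--   * The even binomial coefficients of row m+1 add up to 2^m (Pascal's rule
--     turns them into the whole row m), so Σ_i C(n+2,2i) = 2^{n+1} − 1.
-- The file first develops finite sums of naturals and these binomial facts,
-- then the rational bookkeeping (fractions with a common denominator), and
-- finally the recurrence for L and the theorem.

open import Defs
open import Data.Nat using (ℕ; _≥_)
open import Relation.Binary.PropositionalEquality using (_≡_)

open import Data.Nat using (zero; suc; _+_; _*_; _∸_; _^_; _<_; s≤s; z≤n)
import Data.Nat.Properties as ℕP
open import Data.Nat.Combinatorics using (_C_; nCk+nC[k+1]≡[n+1]C[k+1]; nC1≡n)
open import Data.Nat.Combinatorics.Specification using (k>n⇒nCk≡0)
import Data.Nat.Solver as ℕSolver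
import Data.Integer as ℤ
open import Data.Integer using (+_)
open import Data.Integer.Properties using (pos-+; pos-*)
import Data.Integer.Solver as ℤSolver
open import Data.Rational using (ℚ; _/_; toℚᵘ) renaming (_+_ to _+ℚ_; 0ℚ to 0q)
import Data.Rational.Properties as ℚP
open import Data.Rational.Unnormalised using (mkℚᵘ; *≡*; _≃_) renaming (_+_ to _+ᵘ_)
import Data.Rational.Unnormalised.Properties as ℚᵘP
open import Algebra.Bundles using (CommutativeMonoid)
import Algebra.Properties.CommutativeSemigroup as CommSemigroupProperties
open import Relation.Binary.PropositionalEquality using (refl; sym; trans; cong; cong₂; module ≡-Reasoning)
open ≡-Reasoning

sumBelow : ℕ → (ℕ → ℕ) → ℕ
sumBelow zero    f = 0
sumBelow (suc n) f = sumBelow n f + f n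

sumBelow-cong : ∀ n {f g : ℕ → ℕ} → (∀ k → f k ≡ g k) → sumBelow n f ≡ sumBelow n g
sumBelow-cong zero    f≡g = refl
sumBelow-cong (suc n) f≡g = cong₂ _+_ (sumBelow-cong n f≡g) (f≡g n)

sum-in-pairs : ∀ n (f : ℕ → ℕ) →
               f 0 + sumBelow n (λ k → f (suc (2 * k)) + f (suc (suc (2 * k))))
                 ≡ sumBelow (suc (2 * n)) f
sum-in-pairs zero    f = ℕP.+-comm (f 0) 0
sum-in-pairs (suc n) f = begin
  f 0 + (sumBelow n pairs + (f (1 + 2 * n) + f (2 + 2 * n)))
    ≡⟨ sym (ℕP.+-assoc (f 0) _ _) ⟩
  (f 0 + sumBelow n pairs) + (f (1 + 2 * n) + f (2 + 2 * n))
    ≡⟨ cong (_+ (f (1 + 2 * n) + f (2 + 2 * n))) (sum-in-pairs n f) ⟩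
  sumBelow (1 + 2 * n) f + (f (1 + 2 * n) + f (2 + 2 * n))
    ≡⟨ sym (ℕP.+-assoc (sumBelow (1 + 2 * n) f) _ _) ⟩
  sumBelow (3 + 2 * n) f
    ≡⟨ cong (λ m → sumBelow (suc m) f) (sym (ℕP.*-suc 2 n)) ⟩
  sumBelow (suc (2 * suc n)) f ∎
  where
  pairs : ℕ → ℕ
  pairs k = f (suc (2 * k)) + f (suc (suc (2 * k)))

absorption : ∀ n k → suc k * (suc n C suc k) ≡ suc n * (n C k)
absorption n zero = begin
  1 * (suc n C 1) ≡⟨ ℕP.*-identityˡ _ ⟩
  suc n C 1       ≡⟨ nC1≡n (suc n) ⟩
  suc n           ≡⟨ sym (ℕP.*-identityʳ (suc n)) ⟩
  suc n * 1       ∎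
absorption zero (suc k) = ℕP.*-zeroʳ (suc (suc k))
absorption (suc n) (suc j) = begin
  (2 + j) * (suc (suc n) C suc (suc j))
    ≡⟨ cong ((2 + j) *_) (sym (nCk+nC[k+1]≡[n+1]C[k+1] (suc n) (suc j))) ⟩
  (2 + j) * (A + B)
    ≡⟨ solve 3 (λ j A B → (con 2 :+ j) :* (A :+ B) := A :+ (con 1 :+ j) :* A :+ (con 2 :+ j) :* B) refl j A B ⟩
  A + suc j * A + (2 + j) * B
    ≡⟨ cong₂ (λ x y → A + x + y) (absorption n j) (absorption n (suc j)) ⟩
  A + suc n * (n C j) + suc n * (n C suc j)
    ≡⟨ solve 4 (λ A n x y → A :+ (con 1 :+ n) :* x :+ (con 1 :+ n) :* y := A :+ (con 1 :+ n) :* (x :+ y)) refl A n (n C j) (n C suc j) ⟩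
  A + suc n * (n C j + n C suc j)
    ≡⟨ cong (λ x → A + suc n * x) (nCk+nC[k+1]≡[n+1]C[k+1] n j) ⟩
  suc (suc n) * A ∎
  where
  open ℕSolver.+-*-Solver
  A = suc n C suc j
  B = suc n C suc (suc j)

sum-pascal : ∀ m N → sumBelow (suc N) (suc m C_) ≡ sumBelow N (m C_) + sumBelow (suc N) (m C_)
sum-pascal m zero = refl
sum-pascal m (suc N) = begin
  sumBelow (suc N) (suc m C_) + suc m C suc N
    ≡⟨ cong₂ _+_ (sum-pascal m N) (sym (nCk+nC[k+1]≡[n+1]C[k+1] m N)) ⟩
  (sumBelow N (m C_) + sumBelow (suc N) (m C_)) + (m C N + m C suc N)
    ≡⟨ interchange (sumBelow N (m C_)) _ (m C N) _ ⟩
  sumBelow (suc N) (m C_) + sumBelow (suc (suc N)) (m C_) ∎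
  where open CommSemigroupProperties ℕP.+-commutativeSemigroup using (interchange)

row-sum-zero : ∀ t → sumBelow (suc t) (0 C_) ≡ 1
row-sum-zero zero    = refl
row-sum-zero (suc t) = trans (ℕP.+-identityʳ _) (row-sum-zero t)

row-sum : ∀ m t → sumBelow (suc m + t) (m C_) ≡ 2 ^ m
row-sum zero    t = row-sum-zero t
row-sum (suc m) t = begin
  sumBelow (suc (suc m + t)) (suc m C_)
    ≡⟨ sum-pascal m (suc m + t) ⟩
  sumBelow (suc m + t) (m C_) + sumBelow (suc (suc m + t)) (m C_)
    ≡⟨ cong (λ N → sumBelow (suc m + t) (m C_) + sumBelow N (m C_)) (sym (ℕP.+-suc (suc m) t)) ⟩
  sumBelow (suc m + t) (m C_) + sumBelow (suc m + suc t) (m C_)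
    ≡⟨ cong₂ _+_ (row-sum m t) (row-sum m (suc t)) ⟩
  2 ^ m + 2 ^ m
    ≡⟨ cong (λ x → 2 ^ m + x) (sym (ℕP.+-identityʳ (2 ^ m))) ⟩
  2 ^ suc m ∎

even-row-sum : ∀ m → 1 + sumBelow m (λ k → suc m C (2 * suc k)) ≡ 2 ^ m
even-row-sum m = begin
  1 + sumBelow m (λ k → suc m C (2 * suc k))
    ≡⟨ cong (λ x → 1 + x) (sumBelow-cong m pascal-at-even) ⟩
  m C 0 + sumBelow m (λ k → m C suc (2 * k) + m C suc (suc (2 * k)))
    ≡⟨ sum-in-pairs m (m C_) ⟩
  sumBelow (suc (2 * m)) (m C_)
    ≡⟨ cong (λ r → sumBelow (suc (m + r)) (m C_)) (ℕP.+-identityʳ m) ⟩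
  sumBelow (suc m + m) (m C_)
    ≡⟨ row-sum m m ⟩
  2 ^ m ∎
  where
  pascal-at-even : ∀ k → suc m C (2 * suc k) ≡ m C suc (2 * k) + m C suc (suc (2 * k))
  pascal-at-even k = trans (cong (suc m C_) (ℕP.*-suc 2 k))
                           (sym (nCk+nC[k+1]≡[n+1]C[k+1] m (suc (2 * k))))

fraction-+ : ∀ a b d → (+ a) / suc d +ℚ (+ b) / suc d ≡ (+ (a + b)) / suc d
fraction-+ a b d = ℚP.toℚᵘ-injective (begin≃
  toℚᵘ ((+ a) / suc d +ℚ (+ b) / suc d)  ≈⟨ ℚP.toℚᵘ-homo-+ ((+ a) / suc d) ((+ b) / suc d) ⟩
  toℚᵘ ((+ a) / suc d) +ᵘ toℚᵘ ((+ b) / suc d)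
    ≈⟨ ℚᵘP.+-cong (ℚP.toℚᵘ-fromℚᵘ (mkℚᵘ (+ a) d)) (ℚP.toℚᵘ-fromℚᵘ (mkℚᵘ (+ b) d)) ⟩
  mkℚᵘ (+ a) d +ᵘ mkℚᵘ (+ b) d          ≈⟨ add-numerators ⟩
  mkℚᵘ (+ (a + b)) d                     ≈⟨ ℚᵘP.≃-sym (ℚP.toℚᵘ-fromℚᵘ (mkℚᵘ (+ (a + b)) d)) ⟩
  toℚᵘ ((+ (a + b)) / suc d)             ∎≃)
  where
  open ℚᵘP.≃-Reasoning using (step-≈-⟩) renaming (begin_ to begin≃_; _∎ to _∎≃)
  open ℤSolver.+-*-Solver
  add-numerators : mkℚᵘ (+ a) d +ᵘ mkℚᵘ (+ b) d ≃ mkℚᵘ (+ (a + b)) d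
  add-numerators = *≡* (trans
    (solve 3 (λ A B D → (A :* D :+ B :* D) :* D := (A :+ B) :* (D :* D)) refl (+ a) (+ b) (+ suc d))
    (cong (ℤ._* (+ suc d ℤ.* + suc d)) (sym (pos-+ a b))))

fraction-cross : ∀ a c d d' → a * suc d' ≡ c * suc d → (+ a) / suc d ≡ (+ c) / suc d'
fraction-cross a c d d' cross = ℚP.fromℚᵘ-cong {mkℚᵘ (+ a) d} {mkℚᵘ (+ c) d'}
  (*≡* (trans (sym (pos-* a (suc d'))) (trans (cong +_ cross) (pos-* c (suc d)))))

binomial-fraction-split : ∀ N k →
  (+ (suc N C suc k)) / suc k ≡ (+ (suc N C suc k)) / suc N +ℚ (+ (N C suc k)) / suc k
binomial-fraction-split N k = begin
  (+ (suc N C suc k)) / suc k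
    ≡⟨ cong (λ c → (+ c) / suc k) (sym (nCk+nC[k+1]≡[n+1]C[k+1] N k)) ⟩
  (+ (N C k + N C suc k)) / suc k
    ≡⟨ sym (fraction-+ (N C k) (N C suc k) k) ⟩
  (+ (N C k)) / suc k +ℚ (+ (N C suc k)) / suc k
    ≡⟨ cong (_+ℚ (+ (N C suc k)) / suc k) (fraction-cross (N C k) (suc N C suc k) k N cross) ⟩
  (+ (suc N C suc k)) / suc N +ℚ (+ (N C suc k)) / suc k ∎
  where
  cross : (N C k) * suc N ≡ (suc N C suc k) * suc k
  cross = begin
    (N C k) * suc N          ≡⟨ ℕP.*-comm (N C k) (suc N) ⟩
    suc N * (N C k)          ≡⟨ sym (absorption N k) ⟩
    suc k * (suc N C suc k)  ≡⟨ ℕP.*-comm (suc k) (suc N C suc k) ⟩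
    (suc N C suc k) * suc k  ∎

Σ₁-cong : ∀ n {f g : ℕ → ℚ} → (∀ k → f (suc k) ≡ g (suc k)) → Σ₁ n f ≡ Σ₁ n g
Σ₁-cong zero    f≡g = refl
Σ₁-cong (suc n) f≡g = cong₂ _+ℚ_ (Σ₁-cong n f≡g) (f≡g n)

Σ₁-+ : ∀ n (f g : ℕ → ℚ) → Σ₁ n (λ k → f k +ℚ g k) ≡ Σ₁ n f +ℚ Σ₁ n g
Σ₁-+ zero    f g = sym (ℚP.+-identityˡ 0q)
Σ₁-+ (suc n) f g = trans (cong (_+ℚ (f (suc n) +ℚ g (suc n))) (Σ₁-+ n f g))
                         (interchange (Σ₁ n f) (Σ₁ n g) (f (suc n)) (g (suc n)))
  where
  open CommSemigroupProperties (CommutativeMonoid.commutativeSemigroup ℚP.+-0-commutativeMonoid)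
    using (interchange)

Σ₁-common-denominator : ∀ d (f : ℕ → ℕ) m →
  Σ₁ m (λ k → (+ f k) / suc d) ≡ (+ sumBelow m (λ k → f (suc k))) / suc d
Σ₁-common-denominator d f zero    = sym (ℚP.0/n≡0 (suc d))
Σ₁-common-denominator d f (suc m) =
  trans (cong (_+ℚ (+ f (suc m)) / suc d) (Σ₁-common-denominator d f m))
        (fraction-+ (sumBelow m (λ k → f (suc k))) (f (suc m)) d)

lhsTerm-split : ∀ n k →
  lhsTerm (suc n) (suc k) ≡ (+ (suc (suc n) C (2 * suc k))) / suc (suc n) +ℚ lhsTerm n (suc k)
lhsTerm-split n k = begin
  (+ (suc (n + 1) C (2 * suc k))) / suc K
    ≡⟨ cong₂ (λ N j → (+ (suc N C j)) / suc K) n+1≡1+n (ℕP.*-suc 2 k) ⟩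
  (+ (suc (suc n) C suc K)) / suc K
    ≡⟨ binomial-fraction-split (suc n) K ⟩
  (+ (suc (suc n) C suc K)) / suc (suc n) +ℚ (+ (suc n C suc K)) / suc K
    ≡⟨ sym (cong₂ (λ N j → (+ (suc (suc n) C j)) / suc (suc n) +ℚ (+ (N C j)) / suc K)
                  n+1≡1+n (ℕP.*-suc 2 k)) ⟩
  (+ (suc (suc n) C (2 * suc k))) / suc (suc n) +ℚ lhsTerm n (suc k) ∎
  where
  K = suc (2 * k)
  n+1≡1+n : n + 1 ≡ suc n
  n+1≡1+n = ℕP.+-comm n 1

lhsTerm-beyond : ∀ n → lhsTerm n (suc n) ≡ 0q
lhsTerm-beyond n = trans (cong (λ c → (+ c) / suc (suc (2 * n))) (k>n⇒nCk≡0 n+1<2[n+1]))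
                         (ℚP.0/n≡0 (suc (suc (2 * n))))
  where
  n+1<2[n+1] : n + 1 < 2 * suc n
  n+1<2[n+1] = s≤s (ℕP.+-monoʳ-≤ n (s≤s z≤n))

lhs-increment : ∀ n → Σ₁ (suc n) (lhsTerm (suc n)) ≡ Σ₁ n (lhsTerm n) +ℚ rhsTerm (suc n)
lhs-increment n = begin
  Σ₁ (suc n) (lhsTerm (suc n))
    ≡⟨ Σ₁-cong (suc n) (lhsTerm-split n) ⟩
  Σ₁ (suc n) (λ k → evenTerm k +ℚ lhsTerm n k)
    ≡⟨ Σ₁-+ (suc n) evenTerm (lhsTerm n) ⟩
  Σ₁ (suc n) evenTerm +ℚ (Σ₁ n (lhsTerm n) +ℚ lhsTerm n (suc n))
    ≡⟨ cong (λ x → Σ₁ (suc n) evenTerm +ℚ (Σ₁ n (lhsTerm n) +ℚ x)) (lhsTerm-beyond n) ⟩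
  Σ₁ (suc n) evenTerm +ℚ (Σ₁ n (lhsTerm n) +ℚ 0q)
    ≡⟨ cong (Σ₁ (suc n) evenTerm +ℚ_) (ℚP.+-identityʳ _) ⟩
  Σ₁ (suc n) evenTerm +ℚ Σ₁ n (lhsTerm n)
    ≡⟨ ℚP.+-comm (Σ₁ (suc n) evenTerm) _ ⟩
  Σ₁ n (lhsTerm n) +ℚ Σ₁ (suc n) evenTerm
    ≡⟨ cong (Σ₁ n (lhsTerm n) +ℚ_) (Σ₁-common-denominator (suc n) (λ k → suc (suc n) C (2 * k)) (suc n)) ⟩
  Σ₁ n (lhsTerm n) +ℚ (+ evenSum) / suc (suc n)
    ≡⟨ cong (λ s → Σ₁ n (lhsTerm n) +ℚ (+ s) / suc (suc n)) evenSum≡2^[n+1]∸1 ⟩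
  Σ₁ n (lhsTerm n) +ℚ rhsTerm (suc n) ∎
  where
  evenTerm : ℕ → ℚ
  evenTerm k = (+ (suc (suc n) C (2 * k))) / suc (suc n)
  evenSum : ℕ
  evenSum = sumBelow (suc n) (λ k → suc (suc n) C (2 * suc k))
  evenSum≡2^[n+1]∸1 : evenSum ≡ 2 ^ suc n ∸ 1
  evenSum≡2^[n+1]∸1 = trans (sym (ℕP.m+n∸m≡n 1 evenSum)) (cong (_∸ 1) (even-row-sum (suc n)))

lemma6 : (n : ℕ) → n ≥ 1 → Σ₁ n (lhsTerm n) ≡ Σ₁ n rhsTerm
lemma6 n _ = both-sides-agree n
  where
  both-sides-agree : ∀ n → Σ₁ n (lhsTerm n) ≡ Σ₁ n rhsTerm
  both-sides-agree zero    = refl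
  both-sides-agree (suc n) = trans (lhs-increment n) (cong (_+ℚ rhsTerm (suc n)) (both-sides-agree n))
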